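{- Let $G$ be the Petersen graph and let $\mathcal{Cy}$ be the class of all disjoint unions of cycles. Then $c_g^{\mathcal{Cy}}(G)=c_\ell^{\mathcal{Cy}}(G)=3$ and $c_f^{\mathcal{Cy}}(G)=2$.
   Context: All graphs are finite and simple. For a class $\mathcal{T}$ of graphs closed under disjoint union and a graph $G=(V,E)$, a cover of $G$ w.r.t. $\mathcal{T}$ is an edge-surjective graph homomorphism $\varphi$ from a disjoint union $T_1\dot{\cup}\cdots\dot{\cup}T_k$ with all $T_i\in\mathcal{T}$ to $G$; its size is $k$; it is injective if each restriction $\varphi|_{T_i}$ is injective. $c_g^{\mathcal{T}}(G)$ is the minimum size of an injective cover; $c_\ell^{\mathcal{T}}(G)$ is the minimum over injective covers of $\max_{v\in V}|\varphi^{ -1}(v)|$; $c_f^{\mathcal{T}}(G)$ is the minimum over covers of size $1$ of $\max_{v\in V}|\varphi^{ -1}(v)|$. -}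

module Defs where

open import Data.Nat using (ℕ; zero; suc; _+_; _≤_; _⊔_)
open import Data.Fin using (Fin; toℕ; splitAt; _≟_)
open import Data.Sum using (_⊎_; inj₁; inj₂)
open import Data.Product using (Σ; ∃; ∃-syntax; _×_; _,_)
open import Data.Empty using (⊥)
open import Data.List using (List; []; _∷_; length; filter; map; foldr; allFin)
open import Data.Nat.ListAction using (sum)
open import Data.List.Membership.Propositional using (_∈_)
open import Relation.Binary.PropositionalEquality using (_≡_)
open import Function.Definitions using (Injective)

-- Finite graphs on vertex set Fin n, adjacency given as a relation.
-- (All concrete graphs used below are simple: symmetric, irreflexive.)

record Graph : Set₁ where
  field
    n   : ℕ
    Adj : Fin n → Fin n → Set
open Graph public

emptyGraph : Graph
emptyGraph = record { n = 0 ; Adj = λ _ _ → ⊥ }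

-- The cycle C_m on vertices 0..m-1 (used only with m ≥ 3).
cycleAdj : (m : ℕ) → Fin m → Fin m → Set
cycleAdj m i j =
  (toℕ j ≡ suc (toℕ i)) ⊎ (toℕ i ≡ suc (toℕ j))
  ⊎ (toℕ i ≡ 0 × suc (toℕ j) ≡ m) ⊎ (toℕ j ≡ 0 × suc (toℕ i) ≡ m)

cycleGraph : ℕ → Graph
cycleGraph m = record { n = m ; Adj = cycleAdj m }

-- Disjoint union of two graphs (vertices of G first, then those of H).
sumAdj : (G H : Graph) → Fin (n G) ⊎ Fin (n H) → Fin (n G) ⊎ Fin (n H) → Set
sumAdj G H (inj₁ a) (inj₁ b) = Adj G a b
sumAdj G H (inj₂ a) (inj₂ b) = Adj H a b
sumAdj G H (inj₁ _) (inj₂ _) = ⊥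
sumAdj G H (inj₂ _) (inj₁ _) = ⊥

_⊕_ : Graph → Graph → Graph
G ⊕ H = record
  { n   = n G + n H
  ; Adj = λ x y → sumAdj G H (splitAt (n G) x) (splitAt (n G) y) }

-- The class Cy of disjoint unions of cycles: a member is described by the
-- list of its cycle lengths, an entry l standing for a cycle of length 3 + l.
-- (Every graph in Cy is isomorphic to some cyc ls; all notions below are
-- invariant under isomorphism of the pieces.)
cyc : List ℕ → Graph
cyc []       = emptyGraph
cyc (l ∷ ls) = cycleGraph (3 + l) ⊕ cyc ls

-- A cover of G of size k is an edge-surjective homomorphism from
-- T_1 ⊔ ... ⊔ T_k (T_i ∈ Cy) to G; a homomorphism out of a disjoint union
-- is the same as a family of homomorphisms φ_i : T_i → G.

record Cover (G : Graph) (k : ℕ) : Set where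
  field
    shape : Fin k → List ℕ
    φ     : (i : Fin k) → Fin (n (cyc (shape i))) → Fin (n G)
    hom   : ∀ i x y → Adj (cyc (shape i)) x y → Adj G (φ i x) (φ i y)
    surj  : ∀ u v → Adj G u v →
            ∃[ i ] ∃[ x ] ∃[ y ] (Adj (cyc (shape i)) x y × φ i x ≡ u × φ i y ≡ v)
open Cover public

InjectiveCover : ∀ {G k} → Cover G k → Set
InjectiveCover c = ∀ i → Injective _≡_ _≡_ (φ c i)

preimageCount : ∀ {m p} → (Fin m → Fin p) → Fin p → ℕ
preimageCount {m} f v = length (filter (λ x → f x ≟ v) (allFin m))

load : ∀ {G k} → Cover G k → Fin (n G) → ℕ
load {G} {k} c v = sum (map (λ i → preimageCount (φ c i) v) (allFin k))

maxLoad : ∀ {G k} → Cover G k → ℕ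
maxLoad {G} c = foldr _⊔_ 0 (map (load c) (allFin (n G)))

IsMinimum : (ℕ → Set) → ℕ → Set
IsMinimum P m = P m × (∀ k → P k → m ≤ k)

cg≡ : Graph → ℕ → Set
cg≡ G = IsMinimum (λ k → Σ (Cover G k) InjectiveCover)

cℓ≡ : Graph → ℕ → Set
cℓ≡ G = IsMinimum (λ m → ∃[ k ] Σ (Cover G k) (λ c → InjectiveCover c × maxLoad c ≡ m))

cf≡ : Graph → ℕ → Set
cf≡ G = IsMinimum (λ m → Σ (Cover G 1) (λ c → maxLoad c ≡ m))

petersenEdges : List (ℕ × ℕ)
petersenEdges =
  (0 , 1) ∷ (1 , 2) ∷ (2 , 3) ∷ (3 , 4) ∷ (4 , 0) ∷
  (0 , 5) ∷ (1 , 6) ∷ (2 , 7) ∷ (3 , 8) ∷ (4 , 9) ∷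
  (5 , 7) ∷ (7 , 9) ∷ (9 , 6) ∷ (6 , 8) ∷ (8 , 5) ∷ []

petersen : Graph
petersen = record
  { n   = 10
  ; Adj = λ u v → ((toℕ u , toℕ v) ∈ petersenEdges) ⊎ ((toℕ v , toℕ u) ∈ petersenEdges) }

-- The upper bounds are explicit covers checked by evaluation: an injective cover by three pieces with
-- maximal load 3, and one closed walk of length 20 through every vertex twice.  For c_f ≥ 2: a single
-- piece visiting vertex 0 once sees only the two neighbours of that preimage, but 0 has three neighbours.
-- For c_g, c_ℓ ≥ 3 it suffices to refute an injective cover in which every vertex lies in at most two
-- pieces.  Each piece embeds a 2-regular graph, so its edge set has degree 2 at the vertices it visits.
-- Double counting at v gives Σ_{e ∋ v} m(e) = 2·(visits of v) ≤ 4 with all multiplicities m(e) ≥ 1, so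
-- exactly one edge at v is covered twice: these edges form a perfect matching D, and every piece through
-- v uses D's edge at v.  By exhaustive search each of the six perfect matchings D of P has a 5-cycle C
-- avoiding D that meets every such edge set evenly, whereas the pieces meet C in Σ_{e ∈ C} m(e) = 5 edges.

module Submission where

open import Defs
open import Data.Bool using (Bool; true; false; T; _∧_)
open import Data.Bool.Properties using (T-∧) renaming (_≟_ to _≟𝔹_)
open import Data.Nat using (ℕ; zero; suc; _+_; _*_; _≤_; _<_; z≤n; s≤s; s≤s⁻¹; _⊔_; _≡ᵇ_)
open import Data.Nat.Properties
  using (+-*-semiring; ≤-refl; ≤-reflexive; ≤-antisym; ≤-trans; +-mono-≤; +-monoʳ-≤; +-cancelˡ-≤; +-cancelʳ-≤;
         m≤m+n; m≤n+m; m≤m⊔n; m≤n⇒m≤o⊔n; m≤n⇒m≤1+n; ≤∧≢⇒<; <⇒≢; <-irrefl; ≰⇒>; 0≢1+n; m≢1+n+m;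
         suc-injective; +-identityʳ; ≡ᵇ⇒≡)
  renaming (_≟_ to _≟ℕ_)
open import Data.Nat.Divisibility using (_∣_; _∣?_; _∣0; ∣m∣n⇒∣m+n)
open import Data.Nat.ListAction using (sum)
open import Data.Fin using (Fin; zero; suc; toℕ; splitAt; _↑ˡ_; _↑ʳ_; fromℕ; fromℕ<; inject₁; _≟_)
open import Data.Fin.Patterns
open import Data.Fin.Properties
  using (any?; toℕ<n; toℕ-fromℕ<; toℕ-fromℕ; toℕ-inject₁; toℕ-injective; ↑ˡ-injective; ↑ʳ-injective;
         splitAt-↑ˡ; splitAt-↑ʳ; splitAt⁻¹-↑ˡ; splitAt⁻¹-↑ʳ)
open import Data.Fin.Subset using (Subset; inside; outside)
open import Data.Vec using (Vec; []; _∷_; lookup; tabulate)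
open import Data.Vec.Properties using (≡-dec; lookup∘tabulate)
open import Data.List using (List; []; _∷_; length; map; foldr; filter; allFin)
import Data.List as List
open import Data.List.Membership.Propositional using (_∈_)
open import Data.List.Membership.Propositional.Properties using (∈-filter⁺; ∈-allFin; ∈-map⁺)
open import Data.List.Relation.Unary.Any using (Any; here; there)
import Data.List.Relation.Unary.Any as Any
open import Data.List.Relation.Unary.All using (All)
import Data.List.Relation.Unary.All as All
open import Data.Product using (∃-syntax; _×_; _,_; proj₁; proj₂)
open import Data.Product.Properties using () renaming (≡-dec to ×-≡-dec)
open import Data.List.Membership.DecPropositional (×-≡-dec _≟ℕ_ _≟ℕ_) using (_∈?_)
open import Data.Sum using (_⊎_; inj₁; inj₂)
import Data.Sum
open import Data.Empty using (⊥; ⊥-elim)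
open import Function using (_∘_; _⇔_; mk⇔; Equivalence)
open import Function.Construct.Composition using (_⇔-∘_)
open import Relation.Binary.PropositionalEquality using (_≡_; _≢_; refl; sym; trans; cong; subst; module ≡-Reasoning)
open import Relation.Nullary using (Dec; yes; no; ¬_; ¬?; does)
open import Relation.Nullary.Decidable
  using (map′; isYes; from-yes; from-no; True; toWitness; fromWitness; _⊎-dec_; _×-dec_; _→-dec_; T?;
         dec-true; dec-false; does-⇔)
open import Relation.Unary using (Pred; Decidable)
open import Algebra.Properties.Semiring.Sum +-*-semiring using (sum-syntax; ∑-comm; ∑-distrib-+; *-distribˡ-sum; sum-cong-≗)

pattern 10F = suc 9F
pattern 11F = suc 10F
pattern 12F = suc 11F
pattern 13F = suc 12F
pattern 14F = suc 13F

χ : Bool → ℕ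
χ true  = 1
χ false = 0

χ≤1 : ∀ b → χ b ≤ 1
χ≤1 true  = s≤s z≤n
χ≤1 false = z≤n

χ≡1⇒T : ∀ {b} → χ b ≡ 1 → T b
χ≡1⇒T {true} _ = _

sum-map-tabulate : ∀ {A : Set} {k} (f : A → ℕ) (g : Fin k → A) → sum (map f (List.tabulate g)) ≡ ∑[ i < k ] f (g i)
sum-map-tabulate {k = zero}  f g = refl
sum-map-tabulate {k = suc k} f g = cong (f (g zero) +_) (sum-map-tabulate f (g ∘ suc))

∑-mono-≤ : ∀ {k} {f g : Fin k → ℕ} → (∀ i → f i ≤ g i) → ∑[ i < k ] f i ≤ ∑[ i < k ] g i
∑-mono-≤ {zero}  f≤g = z≤n
∑-mono-≤ {suc k} f≤g = +-mono-≤ (f≤g zero) (∑-mono-≤ (f≤g ∘ suc))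

∑-term : ∀ {k} (f : Fin k → ℕ) i → f i ≤ ∑[ j < k ] f j
∑-term f zero    = m≤m+n (f zero) _
∑-term f (suc i) = ≤-trans (∑-term (f ∘ suc) i) (m≤n+m _ (f zero))

∑-ones : ∀ k → ∑[ i < k ] 1 ≡ k
∑-ones zero    = refl
∑-ones (suc k) = cong suc (∑-ones k)

∑-tight : ∀ {k} {f g : Fin k → ℕ} → (∀ i → f i ≤ g i) → ∑[ i < k ] g i ≤ ∑[ i < k ] f i → ∀ i → f i ≡ g i
∑-tight {suc k} {f} {g} f≤g ∑g≤∑f zero =
  ≤-antisym (f≤g zero) (+-cancelʳ-≤ _ (g zero) (f zero) (≤-trans ∑g≤∑f (+-monoʳ-≤ (f zero) (∑-mono-≤ (f≤g ∘ suc)))))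
∑-tight {suc k} {f} {g} f≤g ∑g≤∑f (suc i) =
  ∑-tight (f≤g ∘ suc) (+-cancelˡ-≤ (g zero) _ _ (≤-trans ∑g≤∑f (+-mono-≤ (f≤g zero) ≤-refl))) i

∑-even : ∀ {k} (f : Fin k → ℕ) → (∀ i → 2 ∣ f i) → 2 ∣ ∑[ i < k ] f i
∑-even {zero}  f even = 2 ∣0
∑-even {suc k} f even = ∣m∣n⇒∣m+n (even zero) (∑-even (f ∘ suc) (even ∘ suc))

χ-witness : ∀ {k} (b : Fin k → Bool) → 0 < ∑[ i < k ] χ (b i) → ∃[ i ] T (b i)
χ-witness {suc k} b pos with b zero in eq
... | true  = zero , subst T (sym eq) _
... | false = let (i , bi) = χ-witness (b ∘ suc) pos in suc i , bi

member⇒nonempty : ∀ {A : Set} {x : A} {xs} → x ∈ xs → 1 ≤ length xs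
member⇒nonempty (here _)  = s≤s z≤n
member⇒nonempty (there _) = s≤s z≤n

two-members : ∀ {A : Set} {x y : A} {xs : List A} → x ∈ xs → y ∈ xs → x ≢ y → 2 ≤ length xs
two-members (here refl) (here refl) x≢y = ⊥-elim (x≢y refl)
two-members (here refl) (there y∈)  _   = s≤s (member⇒nonempty y∈)
two-members (there x∈)  (here refl) _   = s≤s (member⇒nonempty x∈)
two-members (there x∈)  (there y∈)  x≢y = m≤n⇒m≤1+n (two-members x∈ y∈ x≢y)

≤-foldr-⊔ : ∀ {x xs} → x ∈ xs → x ≤ foldr _⊔_ 0 xs
≤-foldr-⊔ {xs = y ∷ ys} (here refl) = m≤m⊔n y _
≤-foldr-⊔ {xs = y ∷ ys} (there x∈)  = m≤n⇒m≤o⊔n y (≤-foldr-⊔ x∈)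

-- Deciding universal statements over Fin n, by the evident recursion (whose boolean component the type
-- checker evaluates much faster than that of Data.Fin.Properties.all?).
allFin? : ∀ {n ℓ} {P : Fin n → Set ℓ} → (∀ i → Dec (P i)) → Dec (∀ i → P i)
allFin? {zero}  P? = yes λ ()
allFin? {suc n} P? = map′ (λ (p₀ , p₊) → λ { zero → p₀ ; (suc i) → p₊ i }) (λ all → all zero , all ∘ suc)
                          (P? zero ×-dec allFin? (P? ∘ suc))

-- Exhaustive search over all subsets of a finite set decides universal statements; the search itself is
-- a boolean computation, which keeps evaluation by the type checker cheap.
everySubset : ∀ n → (Subset n → Bool) → Bool
everySubset zero    p = p []
everySubset (suc n) p = everySubset n (p ∘ (inside ∷_)) ∧ everySubset n (p ∘ (outside ∷_))

everySubset-sound : ∀ n p → T (everySubset n p) → ∀ w → T (p w)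
everySubset-sound zero    p holds []            = holds
everySubset-sound (suc n) p holds (inside ∷ w)  = everySubset-sound n _ (proj₁ (Equivalence.to T-∧ holds)) w
everySubset-sound (suc n) p holds (outside ∷ w) = everySubset-sound n _ (proj₂ (Equivalence.to T-∧ holds)) w

everySubset-complete : ∀ n p → (∀ w → T (p w)) → T (everySubset n p)
everySubset-complete zero    p all = all []
everySubset-complete (suc n) p all =
  Equivalence.from T-∧ (everySubset-complete n _ (all ∘ (inside ∷_)) , everySubset-complete n _ (all ∘ (outside ∷_)))

allSubsets? : ∀ {n ℓ} {P : Pred (Subset n) ℓ} → Decidable P → Dec (∀ w → P w)
allSubsets? {n} P? = map′ (λ holds w → toWitness (everySubset-sound n (isYes ∘ P?) holds w))
                          (λ all → everySubset-complete n (isYes ∘ P?) (λ w → fromWitness (all w)))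
                          (T? (everySubset n (isYes ∘ P?)))

record Neighbours (G : Graph) (x : Fin (n G)) : Set where
  field
    nbr₁ nbr₂ : Fin (n G)
    distinct  : nbr₁ ≢ nbr₂
    adj₁      : Adj G x nbr₁
    adj₂      : Adj G x nbr₂
    only      : ∀ y → Adj G x y → y ≡ nbr₁ ⊎ y ≡ nbr₂

TwoRegular : Graph → Set
TwoRegular G = ∀ x → Neighbours G x

Symmetric : Graph → Set
Symmetric G = ∀ x y → Adj G x y → Adj G y x

DecidableAdj : Graph → Set
DecidableAdj G = ∀ x y → Dec (Adj G x y)

reached⇔ : ∀ {G} {B : Set} {x} (N : Neighbours G x) (f : Fin (n G) → B) {p} →
           (∃[ y ] (Adj G x y × f y ≡ p)) ⇔ (p ≡ f (Neighbours.nbr₁ N) ⊎ p ≡ f (Neighbours.nbr₂ N))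
reached⇔ {G} {B} {x} N f = mk⇔ to from
  where
  open Neighbours N
  to : ∀ {p} → ∃[ y ] (Adj G x y × f y ≡ p) → p ≡ f nbr₁ ⊎ p ≡ f nbr₂
  to (y , x~y , refl) with only y x~y
  ... | inj₁ refl = inj₁ refl
  ... | inj₂ refl = inj₂ refl
  from : ∀ {p} → p ≡ f nbr₁ ⊎ p ≡ f nbr₂ → ∃[ y ] (Adj G x y × f y ≡ p)
  from (inj₁ refl) = nbr₁ , adj₁ , refl
  from (inj₂ refl) = nbr₂ , adj₂ , refl

module CycleGraph (l : ℕ) where
  L : ℕ
  L = suc (suc l)

  next : Fin (suc L) → Fin (suc L)
  next x with toℕ x ≟ℕ L
  ... | yes _   = zero
  ... | no x≢L = fromℕ< (s≤s (≤∧≢⇒< (s≤s⁻¹ (toℕ<n x)) x≢L))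

  toℕ-next : ∀ x → toℕ (next x) ≡ suc (toℕ x) ⊎ (toℕ (next x) ≡ 0 × toℕ x ≡ L)
  toℕ-next x with toℕ x ≟ℕ L
  ... | yes x≡L = inj₂ (refl , x≡L)
  ... | no x≢L = inj₁ (toℕ-fromℕ< (s≤s (≤∧≢⇒< (s≤s⁻¹ (toℕ<n x)) x≢L)))

  prev : Fin (suc L) → Fin (suc L)
  prev zero    = fromℕ L
  prev (suc x) = inject₁ x

  adj-next : ∀ x → cycleAdj (suc L) x (next x)
  adj-next x with toℕ-next x
  ... | inj₁ p       = inj₁ p
  ... | inj₂ (p , q) = inj₂ (inj₂ (inj₂ (p , cong suc q)))

  adj-prev : ∀ x → cycleAdj (suc L) x (prev x)
  adj-prev zero    = inj₂ (inj₂ (inj₁ (refl , cong suc (toℕ-fromℕ L))))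
  adj-prev (suc x) = inj₂ (inj₁ (cong suc (sym (toℕ-inject₁ x))))

  -- the cycle has at least three vertices, so successor and predecessor differ
  next≢prev : ∀ x → next x ≢ prev x
  next≢prev zero e with toℕ-next zero
  ... | inj₁ p = 0≢1+n (suc-injective (trans (sym p) (trans (cong toℕ e) (toℕ-fromℕ L))))
  ... | inj₂ (_ , ())
  next≢prev (suc x) e with toℕ-next (suc x)
  ... | inj₁ p       = m≢1+n+m (toℕ x) (sym (trans (sym p) (trans (cong toℕ e) (toℕ-inject₁ x))))
  ... | inj₂ (p , q) = <⇒≢ (s≤s z≤n) (trans (sym p) (trans (cong toℕ e) (trans (toℕ-inject₁ x) (suc-injective q))))

  only : ∀ x y → cycleAdj (suc L) x y → y ≡ next x ⊎ y ≡ prev x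
  only x y (inj₁ y≡1+x) with toℕ-next x
  ... | inj₁ p       = inj₁ (toℕ-injective (trans y≡1+x (sym p)))
  ... | inj₂ (_ , q) = ⊥-elim (<⇒≢ (toℕ<n y) (trans y≡1+x (cong suc q)))
  only (suc x) y (inj₂ (inj₁ x≡1+y)) =
    inj₂ (toℕ-injective (trans (sym (suc-injective x≡1+y)) (sym (toℕ-inject₁ x))))
  only zero y (inj₂ (inj₂ (inj₁ (_ , y≡L)))) = inj₂ (toℕ-injective (trans (suc-injective y≡L) (sym (toℕ-fromℕ L))))
  only (suc x) y (inj₂ (inj₂ (inj₁ (() , _))))
  only x y (inj₂ (inj₂ (inj₂ (y≡0 , x≡L)))) with toℕ-next x
  ... | inj₁ p       = ⊥-elim (<⇒≢ (toℕ<n (next x)) (trans p x≡L))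
  ... | inj₂ (p , _) = inj₁ (toℕ-injective (trans y≡0 (sym p)))

  neighbours : TwoRegular (cycleGraph (suc L))
  neighbours x = record
    { nbr₁ = next x ; nbr₂ = prev x ; distinct = next≢prev x
    ; adj₁ = adj-next x ; adj₂ = adj-prev x ; only = only x }

cycle-symmetric : ∀ m → Symmetric (cycleGraph m)
cycle-symmetric m x y (inj₁ p)                = inj₂ (inj₁ p)
cycle-symmetric m x y (inj₂ (inj₁ p))         = inj₁ p
cycle-symmetric m x y (inj₂ (inj₂ (inj₁ p)))  = inj₂ (inj₂ (inj₂ p))
cycle-symmetric m x y (inj₂ (inj₂ (inj₂ p)))  = inj₂ (inj₂ (inj₁ p))

cycle-adj? : ∀ m → DecidableAdj (cycleGraph m)
cycle-adj? m x y = (toℕ y ≟ℕ suc (toℕ x)) ⊎-dec (toℕ x ≟ℕ suc (toℕ y))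
  ⊎-dec ((toℕ x ≟ℕ 0) ×-dec (suc (toℕ y) ≟ℕ m)) ⊎-dec ((toℕ y ≟ℕ 0) ×-dec (suc (toℕ x) ≟ℕ m))

module DisjointUnion (G H : Graph) where
  inl-adj : ∀ {a b} → Adj G a b → Adj (G ⊕ H) (a ↑ˡ n H) (b ↑ˡ n H)
  inl-adj {a} {b} rewrite splitAt-↑ˡ (n G) a (n H) | splitAt-↑ˡ (n G) b (n H) = λ a~b → a~b

  inr-adj : ∀ {a b} → Adj H a b → Adj (G ⊕ H) (n G ↑ʳ a) (n G ↑ʳ b)
  inr-adj {a} {b} rewrite splitAt-↑ʳ (n G) (n H) a | splitAt-↑ʳ (n G) (n H) b = λ a~b → a~b

  inl-adj⁻¹ : ∀ {a} y → Adj (G ⊕ H) (a ↑ˡ n H) y → ∃[ b ] (y ≡ b ↑ˡ n H × Adj G a b)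
  inl-adj⁻¹ {a} y a~y with splitAt (n G) y in eq
  ... | inj₁ b rewrite splitAt-↑ˡ (n G) a (n H) = b , sym (splitAt⁻¹-↑ˡ eq) , a~y
  ... | inj₂ b rewrite splitAt-↑ˡ (n G) a (n H) = ⊥-elim a~y

  inr-adj⁻¹ : ∀ {a} y → Adj (G ⊕ H) (n G ↑ʳ a) y → ∃[ b ] (y ≡ n G ↑ʳ b × Adj H a b)
  inr-adj⁻¹ {a} y a~y with splitAt (n G) y in eq
  ... | inj₁ b rewrite splitAt-↑ʳ (n G) (n H) a = ⊥-elim a~y
  ... | inj₂ b rewrite splitAt-↑ʳ (n G) (n H) a = b , sym (splitAt⁻¹-↑ʳ eq) , a~y

  inl-neighbours : ∀ {a} → Neighbours G a → Neighbours (G ⊕ H) (a ↑ˡ n H)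
  inl-neighbours N = record
    { nbr₁ = nbr₁ ↑ˡ n H ; nbr₂ = nbr₂ ↑ˡ n H
    ; distinct = distinct ∘ ↑ˡ-injective (n H) nbr₁ nbr₂
    ; adj₁ = inl-adj adj₁ ; adj₂ = inl-adj adj₂
    ; only = λ y a~y → let (b , y≡b , a~b) = inl-adj⁻¹ y a~y in
               Data.Sum.map (λ e → trans y≡b (cong (_↑ˡ n H) e)) (λ e → trans y≡b (cong (_↑ˡ n H) e)) (only b a~b) }
    where open Neighbours N

  inr-neighbours : ∀ {a} → Neighbours H a → Neighbours (G ⊕ H) (n G ↑ʳ a)
  inr-neighbours N = record
    { nbr₁ = n G ↑ʳ nbr₁ ; nbr₂ = n G ↑ʳ nbr₂
    ; distinct = distinct ∘ ↑ʳ-injective (n G) nbr₁ nbr₂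
    ; adj₁ = inr-adj adj₁ ; adj₂ = inr-adj adj₂
    ; only = λ y a~y → let (b , y≡b , a~b) = inr-adj⁻¹ y a~y in
               Data.Sum.map (λ e → trans y≡b (cong (n G ↑ʳ_) e)) (λ e → trans y≡b (cong (n G ↑ʳ_) e)) (only b a~b) }
    where open Neighbours N

  two-regular : TwoRegular G → TwoRegular H → TwoRegular (G ⊕ H)
  two-regular nG nH x with splitAt (n G) x in eq
  ... | inj₁ a = subst (Neighbours (G ⊕ H)) (splitAt⁻¹-↑ˡ eq) (inl-neighbours (nG a))
  ... | inj₂ b = subst (Neighbours (G ⊕ H)) (splitAt⁻¹-↑ʳ eq) (inr-neighbours (nH b))

  symmetric : Symmetric G → Symmetric H → Symmetric (G ⊕ H)
  symmetric sG sH x y = on-parts (splitAt (n G) x) (splitAt (n G) y)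
    where
    on-parts : ∀ p q → sumAdj G H p q → sumAdj G H q p
    on-parts (inj₁ a) (inj₁ b) = sG a b
    on-parts (inj₂ a) (inj₂ b) = sH a b

  adj? : DecidableAdj G → DecidableAdj H → DecidableAdj (G ⊕ H)
  adj? dG dH x y = on-parts (splitAt (n G) x) (splitAt (n G) y)
    where
    on-parts : ∀ p q → Dec (sumAdj G H p q)
    on-parts (inj₁ a) (inj₁ b) = dG a b
    on-parts (inj₂ a) (inj₂ b) = dH a b
    on-parts (inj₁ a) (inj₂ b) = no λ ()
    on-parts (inj₂ a) (inj₁ b) = no λ ()

cyc-two-regular : ∀ ls → TwoRegular (cyc ls)
cyc-two-regular []       ()
cyc-two-regular (l ∷ ls) = DisjointUnion.two-regular _ _ (CycleGraph.neighbours l) (cyc-two-regular ls)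

cyc-symmetric : ∀ ls → Symmetric (cyc ls)
cyc-symmetric []       ()
cyc-symmetric (l ∷ ls) = DisjointUnion.symmetric _ _ (cycle-symmetric (3 + l)) (cyc-symmetric ls)

cyc-adj? : ∀ ls → DecidableAdj (cyc ls)
cyc-adj? []       ()
cyc-adj? (l ∷ ls) = DisjointUnion.adj? _ _ (cycle-adj? (3 + l)) (cyc-adj? ls)

module Preimages {m p} (f : Fin m → Fin p) (v : Fin p) where
  fiber-member : ∀ {x} → f x ≡ v → x ∈ filter (λ y → f y ≟ v) (allFin m)
  fiber-member {x} fx≡v = ∈-filter⁺ (λ y → f y ≟ v) (∈-allFin x) fx≡v

  preimage-exists : ∀ {x} → f x ≡ v → 1 ≤ preimageCount f v
  preimage-exists = member⇒nonempty ∘ fiber-member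

  preimage-unique : preimageCount f v ≤ 1 → ∀ {x y} → f x ≡ v → f y ≡ v → x ≡ y
  preimage-unique count≤1 {x} {y} fx≡v fy≡v with x ≟ y
  ... | yes x≡y = x≡y
  ... | no  x≢y = ⊥-elim (<-irrefl refl (≤-trans (two-members (fiber-member fx≡v) (fiber-member fy≡v) x≢y) count≤1))

load≡∑ : ∀ {G k} (c : Cover G k) v → load c v ≡ ∑[ i < k ] preimageCount (φ c i) v
load≡∑ c v = sum-map-tabulate (λ i → preimageCount (φ c i) v) (λ i → i)

load≤maxLoad : ∀ {G k} (c : Cover G k) v → load c v ≤ maxLoad c
load≤maxLoad c v = ≤-foldr-⊔ (∈-map⁺ (load c) (∈-allFin v))

pigeonhole : ∀ {A : Set} {a b c p q : A} →
             a ≡ p ⊎ a ≡ q → b ≡ p ⊎ b ≡ q → c ≡ p ⊎ c ≡ q → a ≡ b ⊎ a ≡ c ⊎ b ≡ c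
pigeonhole (inj₁ refl) (inj₁ refl) _           = inj₁ refl
pigeonhole (inj₂ refl) (inj₂ refl) _           = inj₁ refl
pigeonhole (inj₁ refl) (inj₂ refl) (inj₁ refl) = inj₂ (inj₁ refl)
pigeonhole (inj₂ refl) (inj₁ refl) (inj₂ refl) = inj₂ (inj₁ refl)
pigeonhole (inj₁ refl) (inj₂ refl) (inj₂ refl) = inj₂ (inj₂ refl)
pigeonhole (inj₂ refl) (inj₁ refl) (inj₁ refl) = inj₂ (inj₂ refl)

-- A cover by a single member of Cy that visits v at most once sees at most two neighbours of v:
-- all edges at v come from the unique preimage of v, which has only two neighbours.
module SinglePiece {G} (c : Cover G 1) (v : Fin (n G)) (load≤1 : load c v ≤ 1) where
  f = φ c zero
  N = cyc-two-regular (shape c zero)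

  count≤1 : preimageCount f v ≤ 1
  count≤1 = subst (_≤ 1) (+-identityʳ _) load≤1

  neighbour-image : ∀ x → f x ≡ v → ∀ u → Adj G v u → u ≡ f (Neighbours.nbr₁ (N x)) ⊎ u ≡ f (Neighbours.nbr₂ (N x))
  neighbour-image x fx≡v u v~u with surj c v u v~u
  ... | zero , x′ , y , x′~y , fx′≡v , fy≡u with Preimages.preimage-unique f v count≤1 fx′≡v fx≡v
  ... | refl = Equivalence.to (reached⇔ (N x′) f) (y , x′~y , fy≡u)

  degree≤2 : ∀ {u₁ u₂ u₃} → Adj G v u₁ → Adj G v u₂ → Adj G v u₃ → u₁ ≡ u₂ ⊎ u₁ ≡ u₃ ⊎ u₂ ≡ u₃
  degree≤2 {u₁} {u₂} {u₃} v~u₁ v~u₂ v~u₃ with surj c v u₁ v~u₁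
  ... | zero , x , _ , _ , fx≡v , _ =
    pigeonhole (neighbour-image x fx≡v u₁ v~u₁) (neighbour-image x fx≡v u₂ v~u₂) (neighbour-image x fx≡v u₃ v~u₃)

module Construction {G : Graph} (adj? : DecidableAdj G) {k} (shape : Fin k → List ℕ)
                    (ψ : (i : Fin k) → Fin (n (cyc (shape i))) → Fin (n G)) where
  homomorphism? : Dec (∀ i x y → Adj (cyc (shape i)) x y → Adj G (ψ i x) (ψ i y))
  homomorphism? = allFin? λ i → allFin? λ x → allFin? λ y → cyc-adj? (shape i) x y →-dec adj? (ψ i x) (ψ i y)

  edge-surjective? : Dec (∀ u v → Adj G u v → ∃[ i ] ∃[ x ] ∃[ y ] (Adj (cyc (shape i)) x y × ψ i x ≡ u × ψ i y ≡ v))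
  edge-surjective? = allFin? λ u → allFin? λ v → adj? u v →-dec
    (any? λ i → any? λ x → any? λ y → cyc-adj? (shape i) x y ×-dec (ψ i x ≟ u) ×-dec (ψ i y ≟ v))

  injective? : Dec (∀ i x y → ψ i x ≡ ψ i y → x ≡ y)
  injective? = allFin? λ i → allFin? λ x → allFin? λ y → (ψ i x ≟ ψ i y) →-dec (x ≟ y)

  cover : True homomorphism? → True edge-surjective? → Cover G k
  cover hom surj = record { shape = shape ; φ = ψ ; hom = toWitness hom ; surj = toWitness surj }

  cover-injective : ∀ hom surj → True injective? → InjectiveCover (cover hom surj)
  cover-injective _ _ inj i = toWitness inj i _ _

petersen-adj? : DecidableAdj petersen
petersen-adj? u v = ((toℕ u , toℕ v) ∈? petersenEdges) ⊎-dec ((toℕ v , toℕ u) ∈? petersenEdges)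

-- The 15 edges of the Petersen graph, numbered in the order of petersenEdges.
edgeTable : Vec (Fin 10 × Fin 10) 15
edgeTable = (0F , 1F) ∷ (1F , 2F) ∷ (2F , 3F) ∷ (3F , 4F) ∷ (4F , 0F) ∷
            (0F , 5F) ∷ (1F , 6F) ∷ (2F , 7F) ∷ (3F , 8F) ∷ (4F , 9F) ∷
            (5F , 7F) ∷ (7F , 9F) ∷ (9F , 6F) ∷ (6F , 8F) ∷ (8F , 5F) ∷ []

end₁ end₂ : Fin 15 → Fin 10
end₁ e = proj₁ (lookup edgeTable e)
end₂ e = proj₂ (lookup edgeTable e)

incidenceTable : Vec (Vec (Fin 15) 3) 10
incidenceTable =
  (0F ∷ 4F ∷ 5F ∷ []) ∷ (0F ∷ 1F ∷ 6F ∷ []) ∷ (1F ∷ 2F ∷ 7F ∷ []) ∷ (2F ∷ 3F ∷ 8F ∷ []) ∷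
  (3F ∷ 4F ∷ 9F ∷ []) ∷ (5F ∷ 10F ∷ 14F ∷ []) ∷ (6F ∷ 12F ∷ 13F ∷ []) ∷ (7F ∷ 10F ∷ 11F ∷ []) ∷
  (8F ∷ 13F ∷ 14F ∷ []) ∷ (9F ∷ 11F ∷ 12F ∷ []) ∷ []

incident : Fin 10 → Fin 3 → Fin 15
incident v = lookup (lookup incidenceTable v)

across : Fin 10 → Fin 15 → Fin 10
across v e with end₁ e ≟ v
... | yes _ = end₂ e
... | no  _ = end₁ e

neighbour : Fin 10 → Fin 3 → Fin 10
neighbour v j = across v (incident v j)

EndsAt : Fin 10 → Fin 15 → Set
EndsAt v e = (end₁ e ≡ v × end₂ e ≡ across v e) ⊎ (end₁ e ≡ across v e × end₂ e ≡ v)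

InPair : Fin 10 → Fin 10 → Fin 10 → Set
InPair p q u = u ≡ p ⊎ u ≡ q

inPair? : ∀ p q u → Dec (InPair p q u)
inPair? p q u = (u ≟ p) ⊎-dec (u ≟ q)

edge-adj : ∀ e → Adj petersen (end₁ e) (end₂ e)
edge-adj = from-yes (allFin? λ e → petersen-adj? (end₁ e) (end₂ e))

incident-ends : ∀ v j → EndsAt v (incident v j)
incident-ends = from-yes (allFin? λ v → allFin? λ j →
  ((end₁ (incident v j) ≟ v) ×-dec (end₂ (incident v j) ≟ neighbour v j)) ⊎-dec
  ((end₁ (incident v j) ≟ neighbour v j) ×-dec (end₂ (incident v j) ≟ v)))

edge-slot : ∀ e → ∃[ j ] incident (end₁ e) j ≡ e
edge-slot = from-yes (allFin? λ e → any? λ j → incident (end₁ e) j ≟ e)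

pair-count : ∀ v p q → p ≢ q → Adj petersen v p → Adj petersen v q →
             ∑[ j < 3 ] χ (does (inPair? p q (neighbour v j))) ≡ 2
pair-count = from-yes (allFin? λ v → allFin? λ p → allFin? λ q → ¬? (p ≟ q) →-dec (petersen-adj? v p →-dec
  (petersen-adj? v q →-dec (∑[ j < 3 ] χ (does (inPair? p q (neighbour v j))) ≟ℕ 2))))

EdgeSet : Set
EdgeSet = Subset 15

deg : EdgeSet → Fin 10 → ℕ
deg w v = ∑[ j < 3 ] χ (lookup w (incident v j))

IsPerfectMatching : EdgeSet → Set
IsPerfectMatching w = ∀ v → deg w v ≡ 1

Alternating : EdgeSet → EdgeSet → Set
Alternating M w = ∀ v → deg w v ≡ 0 ⊎ (deg w v ≡ 2 × ∃[ j ] (T (lookup M (incident v j)) × T (lookup w (incident v j))))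

alternating? : ∀ M w → Dec (Alternating M w)
alternating? M w = allFin? λ v → (deg w v ≟ℕ 0) ⊎-dec
  ((deg w v ≟ℕ 2) ×-dec any? (λ j → T? (lookup M (incident v j)) ×-dec T? (lookup w (incident v j))))

record Witness : Set where
  constructor _,_
  field
    matching : EdgeSet
    cycle    : Vec (Fin 15) 5
open Witness

pattern I = true
pattern O = false

witnesses : List Witness
witnesses =
  (O ∷ O ∷ O ∷ O ∷ O ∷ I ∷ I ∷ I ∷ I ∷ I ∷ O ∷ O ∷ O ∷ O ∷ O ∷ [] , 0F ∷ 1F ∷ 2F ∷ 3F ∷ 4F ∷ []) ∷
  (O ∷ O ∷ I ∷ O ∷ I ∷ O ∷ I ∷ O ∷ O ∷ O ∷ O ∷ I ∷ O ∷ O ∷ I ∷ [] , 0F ∷ 1F ∷ 5F ∷ 7F ∷ 10F ∷ []) ∷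
  (O ∷ I ∷ O ∷ O ∷ I ∷ O ∷ O ∷ O ∷ I ∷ O ∷ I ∷ O ∷ I ∷ O ∷ O ∷ [] , 0F ∷ 5F ∷ 6F ∷ 13F ∷ 14F ∷ []) ∷
  (O ∷ I ∷ O ∷ I ∷ O ∷ I ∷ O ∷ O ∷ O ∷ O ∷ O ∷ I ∷ O ∷ I ∷ O ∷ [] , 0F ∷ 4F ∷ 6F ∷ 9F ∷ 12F ∷ []) ∷
  (I ∷ O ∷ O ∷ I ∷ O ∷ O ∷ O ∷ I ∷ O ∷ O ∷ O ∷ O ∷ I ∷ O ∷ I ∷ [] , 4F ∷ 5F ∷ 9F ∷ 10F ∷ 11F ∷ []) ∷
  (I ∷ O ∷ I ∷ O ∷ O ∷ O ∷ O ∷ O ∷ O ∷ I ∷ I ∷ O ∷ O ∷ I ∷ O ∷ [] , 3F ∷ 4F ∷ 5F ∷ 8F ∷ 14F ∷ []) ∷ []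

perfect-matchings : ∀ w → IsPerfectMatching w → Any (λ W → w ≡ matching W) witnesses
perfect-matchings = from-yes (allSubsets? λ w →
  (allFin? λ v → deg w v ≟ℕ 1) →-dec Any.any? (λ W → ≡-dec _≟𝔹_ w (matching W)) witnesses)

AvoidsMatching : Witness → Set
AvoidsMatching W = ∀ c → lookup (matching W) (lookup (cycle W) c) ≡ false

meet : Vec (Fin 15) 5 → EdgeSet → ℕ
meet C w = ∑[ c < 5 ] χ (lookup w (lookup C c))

EvenMeets : Witness → Set
EvenMeets W = ∀ w → Alternating (matching W) w → 2 ∣ meet (cycle W) w

parity-witnesses : All (λ W → AvoidsMatching W × EvenMeets W) witnesses
parity-witnesses = from-yes (All.all? (λ W →
  (allFin? λ c → lookup (matching W) (lookup (cycle W) c) ≟𝔹 false) ×-dec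
  (allSubsets? λ w → alternating? (matching W) w →-dec (2 ∣? meet (cycle W) w))) witnesses)

data OneOrTwo : ℕ → Set where
  one : OneOrTwo 1
  two : OneOrTwo 2

one-or-two : ∀ {x} → 1 ≤ x → x ≤ 2 → OneOrTwo x
one-or-two (s≤s z≤n) (s≤s z≤n)       = one
one-or-two (s≤s z≤n) (s≤s (s≤s z≤n)) = two

one-plus-doubled : ∀ {x} → OneOrTwo x → x ≡ 1 + χ (x ≡ᵇ 2)
one-plus-doubled one = refl
one-plus-doubled two = refl

one-unless-doubled : ∀ {x} → OneOrTwo x → (x ≡ᵇ 2) ≡ false → x ≡ 1
one-unless-doubled one _ = refl
one-unless-doubled two ()

three-plus-double : ∀ {d A} → A ≤ 2 → 3 + d ≡ 2 * A → d ≡ 1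
three-plus-double (s≤s (s≤s z≤n)) refl = refl

multiplicity : ∀ {k} → (Fin k → EdgeSet) → Fin 15 → ℕ
multiplicity {k} s e = ∑[ i < k ] χ (lookup (s i) e)

visitCount : ∀ {k} → (Fin k → Fin 10 → Bool) → Fin 10 → ℕ
visitCount {k} a v = ∑[ i < k ] χ (a i v)

module AtMostTwoVisits {k} (s : Fin k → EdgeSet) (a : Fin k → Fin 10 → Bool)
  (covered     : ∀ e → 1 ≤ multiplicity s e)
  (regular     : ∀ i v → deg (s i) v ≡ 2 * χ (a i v))
  (at-most-two : ∀ v → visitCount a v ≤ 2) where

  mult   = multiplicity s
  visits = visitCount a

  -- double counting the edge–piece incidences at v
  handshake : ∀ v → ∑[ j < 3 ] mult (incident v j) ≡ 2 * visits v
  handshake v = begin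
    ∑[ j < 3 ] ∑[ i < k ] χ (lookup (s i) (incident v j)) ≡⟨ ∑-comm (λ j i → χ (lookup (s i) (incident v j))) ⟩
    ∑[ i < k ] deg (s i) v                                 ≡⟨ sum-cong-≗ (λ i → regular i v) ⟩
    ∑[ i < k ] (2 * χ (a i v))                             ≡⟨ sym (*-distribˡ-sum 2 (λ i → χ (a i v))) ⟩
    2 * visits v                                           ∎
    where open ≡-Reasoning

  visited-if-incident : ∀ i v j → χ (lookup (s i) (incident v j)) ≤ χ (a i v)
  visited-if-incident i v j with a i v in visited
  ... | true  = χ≤1 _
  ... | false = ≤-trans (∑-term (λ j → χ (lookup (s i) (incident v j))) j)
                        (≤-reflexive (trans (regular i v) (cong (λ b → 2 * χ b) visited)))

  -- so multiplicities are 1 or 2: edges are covered, and at most as often as an endpoint is visited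
  mult≤visits : ∀ v j → mult (incident v j) ≤ visits v
  mult≤visits v j = ∑-mono-≤ (λ i → visited-if-incident i v j)

  mult-one-or-two : ∀ e → OneOrTwo (mult e)
  mult-one-or-two e =
    subst (OneOrTwo ∘ mult) slot (one-or-two (covered _) (≤-trans (mult≤visits (end₁ e) j) (at-most-two _)))
    where
    j = proj₁ (edge-slot e)
    slot = proj₂ (edge-slot e)

  isDoubled : Fin 15 → Bool
  isDoubled e = mult e ≡ᵇ 2

  doubled : EdgeSet
  doubled = tabulate isDoubled

  -- at each vertex 3 + (number of doubled edges) = 2 · visits ≤ 4, so exactly one edge is doubled
  doubled-perfect : IsPerfectMatching doubled
  doubled-perfect v = three-plus-double (at-most-two v) (begin
    3 + deg doubled v
      ≡⟨ cong (3 +_) (sum-cong-≗ λ j → cong χ (lookup∘tabulate isDoubled (incident v j))) ⟩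
    3 + ∑[ j < 3 ] χ (isDoubled (incident v j))
      ≡⟨ sym (∑-distrib-+ (λ _ → 1) (λ j → χ (isDoubled (incident v j)))) ⟩
    ∑[ j < 3 ] (1 + χ (isDoubled (incident v j)))
      ≡⟨ sym (sum-cong-≗ λ j → one-plus-doubled (mult-one-or-two (incident v j))) ⟩
    ∑[ j < 3 ] mult (incident v j)
      ≡⟨ handshake v ⟩
    2 * visits v ∎)
    where open ≡-Reasoning

  -- both pieces through v use its doubled edge, since that edge is covered as often as v is visited
  alternating : ∀ i → Alternating doubled (s i)
  alternating i v with a i v in visited
  ... | false = inj₁ (trans (regular i v) (cong (λ b → 2 * χ b) visited))
  ... | true  = inj₂ (trans (regular i v) (cong (λ b → 2 * χ b) visited) , j , doubled-j , uses-j)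
    where
    doubled-edge = χ-witness (λ j → lookup doubled (incident v j)) (subst (0 <_) (sym (doubled-perfect v)) (s≤s z≤n))
    j = proj₁ doubled-edge
    doubled-j = proj₂ doubled-edge
    mult≡2 : mult (incident v j) ≡ 2
    mult≡2 = ≡ᵇ⇒≡ _ _ (subst T (lookup∘tabulate isDoubled (incident v j)) doubled-j)
    visits≤mult : visits v ≤ mult (incident v j)
    visits≤mult = ≤-trans (at-most-two v) (≤-reflexive (sym mult≡2))
    uses-j : T (lookup (s i) (incident v j))
    uses-j = χ≡1⇒T (trans (∑-tight (λ i → visited-if-incident i v j) visits≤mult i) (cong χ visited))

  single-off-doubled : ∀ e → lookup doubled e ≡ false → mult e ≡ 1
  single-off-doubled e off = one-unless-doubled (mult-one-or-two e) (trans (sym (lookup∘tabulate isDoubled e)) off)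

  -- doubled is one of the six perfect matchings; its 5-cycle meets every piece evenly, but is covered
  -- exactly once, so the total of the meets is 5
  impossible : ⊥
  impossible = odd-total {Any.lookup found} (All.lookupAny parity-witnesses found)
    where
    found = perfect-matchings doubled doubled-perfect
    odd-total : ∀ {W} → (AvoidsMatching W × EvenMeets W) × doubled ≡ matching W → ⊥
    odd-total {W} ((avoids , even-meets) , doubled≡M) = from-no (2 ∣? 5) (subst (2 ∣_) total (∑-even _ even))
      where
      C = cycle W
      even : ∀ i → 2 ∣ meet C (s i)
      even i = even-meets (s i) (subst (λ M → Alternating M (s i)) doubled≡M (alternating i))
      single : ∀ c → mult (lookup C c) ≡ 1
      single c = single-off-doubled (lookup C c) (trans (cong (λ M → lookup M (lookup C c)) doubled≡M) (avoids c))
      total : ∑[ i < k ] meet C (s i) ≡ 5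
      total = trans (∑-comm (λ i c → χ (lookup (s i) (lookup C c)))) (sum-cong-≗ single)

-- Since the piece is 2-regular and embedded injectively, its trace has
-- degree 2 at visited vertices and 0 elsewhere.
module Trace {k} (c : Cover petersen k) (inj : InjectiveCover c) where
  Piece : Fin k → Graph
  Piece i = cyc (shape c i)

  Covers : Fin k → Fin 15 → Set
  Covers i e = ∃[ x ] ∃[ y ] (Adj (Piece i) x y × φ c i x ≡ end₁ e × φ c i y ≡ end₂ e)

  covers? : ∀ i e → Dec (Covers i e)
  covers? i e = any? λ x → any? λ y → cyc-adj? (shape c i) x y ×-dec (φ c i x ≟ end₁ e) ×-dec (φ c i y ≟ end₂ e)

  Visits : Fin k → Fin 10 → Set
  Visits i v = ∃[ x ] φ c i x ≡ v

  visits? : ∀ i v → Dec (Visits i v)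
  visits? i v = any? λ x → φ c i x ≟ v

  edges : Fin k → EdgeSet
  edges i = tabulate (does ∘ covers? i)

  visited : Fin k → Fin 10 → Bool
  visited i v = does (visits? i v)

  covered : ∀ e → 1 ≤ multiplicity edges e
  covered e = ≤-trans (≤-reflexive (cong χ (sym covers-e))) (∑-term (λ i → χ (lookup (edges i) e)) i)
    where
    i = proj₁ (surj c (end₁ e) (end₂ e) (edge-adj e))
    covering : Covers i e
    covering = proj₂ (surj c (end₁ e) (end₂ e) (edge-adj e))
    covers-e : lookup (edges i) e ≡ true
    covers-e = trans (lookup∘tabulate (does ∘ covers? i) e) (dec-true (covers? i e) covering)

  unvisited : ∀ i {v e} → EndsAt v e → ¬ Visits i v → ¬ Covers i e
  unvisited i (inj₁ (end₁≡v , _)) ¬visit (x , _ , _ , φx , _)  = ¬visit (x , trans φx end₁≡v)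
  unvisited i (inj₂ (_ , end₂≡v)) ¬visit (_ , y , _ , _ , φy) = ¬visit (y , trans φy end₂≡v)

  -- at a visited vertex v = φ x₀, piece i covers the edge e from v to w iff x₀ has a neighbour mapped
  -- to w (by injectivity the covering edge must start at x₀)
  covers⇔reached : ∀ i {v e x₀} → EndsAt v e → φ c i x₀ ≡ v →
                   Covers i e ⇔ (∃[ y ] (Adj (Piece i) x₀ y × φ c i y ≡ across v e))
  covers⇔reached i {v} {e} {x₀} ends φx₀≡v = mk⇔ (to ends) (from ends)
    where
    to : EndsAt v e → Covers i e → ∃[ y ] (Adj (Piece i) x₀ y × φ c i y ≡ across v e)
    to (inj₁ (end₁≡v , end₂≡w)) (x , y , x~y , φx , φy) with inj i (trans (trans φx end₁≡v) (sym φx₀≡v))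
    ... | refl = y , x~y , trans φy end₂≡w
    to (inj₂ (end₁≡w , end₂≡v)) (x , y , x~y , φx , φy) with inj i (trans (trans φy end₂≡v) (sym φx₀≡v))
    ... | refl = x , cyc-symmetric (shape c i) x y x~y , trans φx end₁≡w
    from : EndsAt v e → ∃[ y ] (Adj (Piece i) x₀ y × φ c i y ≡ across v e) → Covers i e
    from (inj₁ (end₁≡v , end₂≡w)) (y , x₀~y , φy) =
      x₀ , y , x₀~y , trans φx₀≡v (sym end₁≡v) , trans φy (sym end₂≡w)
    from (inj₂ (end₁≡w , end₂≡v)) (y , x₀~y , φy) =
      y , x₀ , cyc-symmetric (shape c i) x₀ y x₀~y , trans φy (sym end₁≡w) , trans φx₀≡v (sym end₂≡v)

  -- at a visited vertex the covered edges lead to the images of the two neighbours of its preimage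
  regular : ∀ i v → deg (edges i) v ≡ 2 * χ (visited i v)
  regular i v = trans (sum-cong-≗ λ j → cong χ (lookup∘tabulate (does ∘ covers? i) (incident v j)))
                      (by-visit (visits? i v))
    where
    by-visit : (visit? : Dec (Visits i v)) → ∑[ j < 3 ] χ (does (covers? i (incident v j))) ≡ 2 * χ (does visit?)
    by-visit (no ¬visit) = sum-cong-≗ λ j →
      cong χ (dec-false (covers? i (incident v j)) (unvisited i {v} {incident v j} (incident-ends v j) ¬visit))
    by-visit (yes (x₀ , φx₀≡v)) =
      trans (sum-cong-≗ λ j → cong χ (does-⇔ (covers⇔pair j) (covers? i (incident v j)) (inPair? p q (neighbour v j))))
            (pair-count v p q (distinct ∘ inj i) (adjacent adj₁) (adjacent adj₂))
      where
      N = cyc-two-regular (shape c i) x₀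
      open Neighbours N
      p = φ c i nbr₁
      q = φ c i nbr₂
      adjacent : ∀ {y} → Adj (Piece i) x₀ y → Adj petersen v (φ c i y)
      adjacent x₀~y = subst (λ u → Adj petersen u _) φx₀≡v (hom c i x₀ _ x₀~y)
      covers⇔pair : ∀ j → Covers i (incident v j) ⇔ InPair p q (neighbour v j)
      covers⇔pair j = reached⇔ N (φ c i) ⇔-∘ covers⇔reached i {v} {incident v j} (incident-ends v j) φx₀≡v

  visits≤load : ∀ v → visitCount visited v ≤ load c v
  visits≤load v = ≤-trans (∑-mono-≤ (λ i → visit≤count i (visits? i v))) (≤-reflexive (sym (load≡∑ c v)))
    where
    visit≤count : ∀ i (visit? : Dec (Visits i v)) → χ (does visit?) ≤ preimageCount (φ c i) v
    visit≤count i (yes (x , φx≡v)) = Preimages.preimage-exists (φ c i) v φx≡v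
    visit≤count i (no _)           = z≤n

  visits≤pieces : ∀ v → visitCount visited v ≤ k
  visits≤pieces v = ≤-trans (∑-mono-≤ (λ i → χ≤1 (visited i v))) (≤-reflexive (∑-ones k))

  not-at-most-two-visits : ¬ (∀ v → visitCount visited v ≤ 2)
  not-at-most-two-visits = AtMostTwoVisits.impossible edges visited covered regular

-- An injective cover with at most two pieces visits no vertex more than twice.
injective-cover-pieces : ∀ {k} (c : Cover petersen k) → InjectiveCover c → 3 ≤ k
injective-cover-pieces c inj = ≰⇒> λ k≤2 → not-at-most-two-visits (λ v → ≤-trans (visits≤pieces v) k≤2)
  where open Trace c inj

-- An injective cover of maximal load at most 2 visits no vertex more than twice.
injective-cover-load : ∀ {k} (c : Cover petersen k) → InjectiveCover c → 3 ≤ maxLoad c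
injective-cover-load c inj = ≰⇒> λ m≤2 →
  not-at-most-two-visits (λ v → ≤-trans (visits≤load v) (≤-trans (load≤maxLoad c v) m≤2))
  where open Trace c inj

-- A single piece of maximal load at most 1 would see at most two of the neighbours 1, 4, 5 of vertex 0.
single-cover-load : (c : Cover petersen 1) → 2 ≤ maxLoad c
single-cover-load c = ≰⇒> λ m≤1 → distinct (SinglePiece.degree≤2 c 0F (≤-trans (load≤maxLoad c 0F) m≤1)
  (from-yes (petersen-adj? 0F 1F)) (from-yes (petersen-adj? 0F 4F)) (from-yes (petersen-adj? 0F 5F)))
  where
  distinct : ¬ (1F ≡ 4F ⊎ 1F ≡ 5F ⊎ 4F ≡ 5F)
  distinct (inj₁ ())
  distinct (inj₂ (inj₁ ()))
  distinct (inj₂ (inj₂ ()))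

-- Upper bounds: an injective cover by three pieces (the outer and inner 5-cycles, an 8-cycle and a
-- 5-cycle) of maximal load 3, and a closed walk of length 20 through every vertex exactly twice.
threeShapes : Fin 3 → List ℕ
threeShapes 0F = 2 ∷ 2 ∷ []
threeShapes 1F = 5 ∷ []
threeShapes 2F = 2 ∷ []

threeMaps : (i : Fin 3) → Fin (n (cyc (threeShapes i))) → Fin 10
threeMaps 0F = lookup (0F ∷ 1F ∷ 2F ∷ 3F ∷ 4F ∷ 5F ∷ 7F ∷ 9F ∷ 6F ∷ 8F ∷ [])
threeMaps 1F = lookup (0F ∷ 1F ∷ 6F ∷ 8F ∷ 3F ∷ 2F ∷ 7F ∷ 5F ∷ [])
threeMaps 2F = lookup (4F ∷ 9F ∷ 7F ∷ 5F ∷ 0F ∷ [])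

module ThreePieces = Construction petersen-adj? threeShapes threeMaps

threeCover : Cover petersen 3
threeCover = ThreePieces.cover _ _

threeCover-injective : InjectiveCover threeCover
threeCover-injective = ThreePieces.cover-injective _ _ _

walkShape : Fin 1 → List ℕ
walkShape 0F = 17 ∷ []

walkMap : (i : Fin 1) → Fin (n (cyc (walkShape i))) → Fin 10
walkMap 0F = lookup (0F ∷ 1F ∷ 0F ∷ 4F ∷ 3F ∷ 2F ∷ 1F ∷ 6F ∷ 8F ∷ 3F ∷
                     2F ∷ 7F ∷ 5F ∷ 7F ∷ 9F ∷ 4F ∷ 9F ∷ 6F ∷ 8F ∷ 5F ∷ [])

walkCover : Cover petersen 1
walkCover = Construction.cover petersen-adj? walkShape walkMap _ _

proposition8 : cg≡ petersen 3 × cℓ≡ petersen 3 × cf≡ petersen 2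
proposition8 =
  ((threeCover , threeCover-injective) , λ { _ (c , inj) → injective-cover-pieces c inj }) ,
  ((3 , threeCover , threeCover-injective , refl) , λ { _ (_ , c , inj , refl) → injective-cover-load c inj }) ,
  ((walkCover , refl) , λ { _ (c , refl) → single-cover-load c })
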